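{- Let $G$ be a finite group and $S\subseteq G$ a symmetric generating set of $G$ not containing the identity, closed under conjugation. Then the Cayley sum graph $C_\Sigma(G,S)$ is bipartite if and only if $G$ contains a subgroup of index two which does not intersect $S$.
   Context: The Cayley sum graph $C_\Sigma(G,S)$ has vertex set $G$, and $h$ is adjacent to $g$ iff $h=g^{ -1}s$ for some $s\in S$, i.e. iff $gh\in S$ (undirected since $S$ is closed under conjugation; a loop at $g$ occurs when $g^2\in S$). A graph is bipartite if its vertex set is a union of two disjoint sets each containing no edge (in particular no loop). -}

module Defs where

open import Level using (Level; _⊔_)
open import Algebra.Bundles using (Group)
open import Data.Nat using (ℕ)
open import Data.Fin using (Fin)
open import Data.Product using (Σ; ∃; ∃-syntax; _×_)
open import Data.Sum using (_⊎_)
open import Data.Empty using (⊥)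
open import Data.List using (List; foldr)
open import Data.List.Relation.Unary.All using (All)
open import Relation.Nullary using (¬_)
open import Relation.Unary using (Pred)
open import Function.Bundles using (Inverse)
import Relation.Binary.PropositionalEquality as ≡

module _ {c ℓ : Level} (G : Group c ℓ) where
  open Group G

  IsFinite : Set (c ⊔ ℓ)
  IsFinite = ∃[ n ] Inverse setoid (≡.setoid (Fin n))

  Respects : ∀ {p} → Pred Carrier p → Set (c ⊔ ℓ ⊔ p)
  Respects P = ∀ {x y} → x ≈ y → P x → P y

  IsSymmetric : ∀ {p} → Pred Carrier p → Set (c ⊔ p)
  IsSymmetric S = ∀ {s} → S s → S (s ⁻¹)

  ConjugationClosed : ∀ {p} → Pred Carrier p → Set (c ⊔ p)
  ConjugationClosed S = ∀ g {s} → S s → S (g ∙ s ∙ g ⁻¹)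

  prod : List Carrier → Carrier
  prod = foldr _∙_ ε

  Generates : ∀ {p} → Pred Carrier p → Set (c ⊔ ℓ ⊔ p)
  Generates S = ∀ g → ∃[ w ] (All (λ x → S x ⊎ S (x ⁻¹)) w × prod w ≈ g)

  CayleySumAdj : ∀ {p} → Pred Carrier p → Carrier → Carrier → Set p
  CayleySumAdj S g h = S (g ∙ h)

  -- a set of vertices containing no edge (and no loop)
  Independent : ∀ {p q} → Pred Carrier p → Pred Carrier q → Set (c ⊔ p ⊔ q)
  Independent S A = ∀ g h → A g → A h → ¬ CayleySumAdj S g h

  IsBipartite : ∀ {p} → Pred Carrier p → Set (c ⊔ ℓ Level.⊔ Level.suc p)
  IsBipartite {p} S =
    Σ (Pred Carrier p) λ A → Σ (Pred Carrier p) λ B →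
      Respects A × Respects B ×
      (∀ g → A g ⊎ B g) × (∀ g → A g → B g → ⊥) ×
      Independent S A × Independent S B

  record IsSubgroup {p} (H : Pred Carrier p) : Set (c ⊔ ℓ ⊔ p) where
    field
      respects : Respects H
      ε-mem    : H ε
      ∙-mem    : ∀ {x y} → H x → H y → H (x ∙ y)
      ⁻¹-mem   : ∀ {x} → H x → H (x ⁻¹)

  -- index two: exactly two left cosets, H and aH with a ∉ H
  HasIndexTwo : ∀ {p} → Pred Carrier p → Set (c ⊔ p)
  HasIndexTwo H = ∃[ a ] (¬ H a × (∀ x → H x ⊎ H (a ⁻¹ ∙ x)))

  DisjointFrom : ∀ {p q} → Pred Carrier p → Pred Carrier q → Set (c ⊔ p ⊔ q)
  DisjointFrom H S = ∀ x → H x → S x → ⊥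

-- (⇐) If K has index two with cosets K and aK, and K ∩ S = ∅, then these
-- two cosets are independent: a product of two elements of the same coset
-- lies in K, hence outside S.  This needs nothing about S.
--
-- (⇒) Given a bipartition, call two vertices on the same side if both lie in
-- the same part.  Neighbours of a common vertex are on the same side, and
-- since S is conjugation closed, y ~ a⁻¹y⁻¹ ~ y a b for all a, b ∈ S; so
-- right multiplication by a product of two elements of S preserves sides.
-- As S generates G and s₀ ∈ S, every x either preserves sides or s₀⁻¹x does.
-- Hence the side of ε is exactly the set of side-preserving elements; it is
-- a subgroup, its complement is the coset s₀K, and it misses S because ε is
-- adjacent to every element of S.
module Submission where

open import Defs
open import Level using (_⊔_)
open import Algebra.Bundles using (Group)
open import Data.Product using (Σ; ∃; _×_; _,_)
open import Relation.Nullary using (¬_)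
open import Relation.Unary using (Pred)
open import Function.Bundles using (_⇔_; mk⇔)
open import Data.Sum using (_⊎_; inj₁; inj₂; [_,_]′)
open import Data.Empty using (⊥; ⊥-elim)
open import Data.List using ([]; _∷_)
open import Data.List.Relation.Unary.All as All using (All; []; _∷_)
import Algebra.Properties.Group as GroupProperties
import Relation.Binary.Reasoning.Setoid as SetoidReasoning

module IndexTwoCosets {c ℓ p} (G : Group c ℓ) {K : Pred (Group.Carrier G) p}
  (K-sub : IsSubgroup G K) (index : HasIndexTwo G K) where
  open Group G
  open GroupProperties G using (⁻¹-involutive; \\-leftDividesˡ; \\-leftDividesʳ; //-rightDividesʳ)
  open IsSubgroup K-sub

  a : Carrier
  a = let (a , _ , _) = index in a

  a∉K : ¬ K a
  a∉K = let (_ , a∉K , _) = index in a∉K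

  K∪aK : ∀ x → K x ⊎ K (a ⁻¹ ∙ x)
  K∪aK = let (_ , _ , K∪aK) = index in K∪aK

  aK : Pred Carrier p
  aK x = K (a ⁻¹ ∙ x)

  -- the cosets K and aK are disjoint: from a⁻¹g, g ∈ K we would get a ∈ K
  K∩aK : ∀ g → K g → aK g → ⊥
  K∩aK g g∈K a⁻¹g∈K =
    a∉K (respects (⁻¹-involutive a) (⁻¹-mem (respects (//-rightDividesʳ g (a ⁻¹))
                                               (∙-mem a⁻¹g∈K (⁻¹-mem g∈K)))))

  -- the product of two elements of aK lies in K: either ga ∈ K and
  -- gh = (ga)(a⁻¹h), or a⁻¹ga ∈ K and then a = (a⁻¹g)⁻¹(a⁻¹ga) ∈ K
  aK-product : ∀ {g h} → aK g → aK h → K (g ∙ h)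
  aK-product {g} {h} a⁻¹g∈K a⁻¹h∈K with K∪aK (g ∙ a)
  ... | inj₁ ga∈K = respects ga∙a⁻¹h≈gh (∙-mem ga∈K a⁻¹h∈K)
    where
    ga∙a⁻¹h≈gh : g ∙ a ∙ (a ⁻¹ ∙ h) ≈ g ∙ h
    ga∙a⁻¹h≈gh = trans (assoc g a (a ⁻¹ ∙ h)) (∙-congˡ (\\-leftDividesˡ a h))
  ... | inj₂ a⁻¹ga∈K = ⊥-elim (a∉K (respects a≈a (∙-mem (⁻¹-mem a⁻¹g∈K) a⁻¹g∙a∈K)))
    where
    a⁻¹g∙a∈K : K (a ⁻¹ ∙ g ∙ a)
    a⁻¹g∙a∈K = respects (sym (assoc (a ⁻¹) g a)) a⁻¹ga∈K
    a≈a : (a ⁻¹ ∙ g) ⁻¹ ∙ (a ⁻¹ ∙ g ∙ a) ≈ a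
    a≈a = \\-leftDividesʳ (a ⁻¹ ∙ g) a

  cosetsBipartite : (S : Pred Carrier p) → DisjointFrom G K S → IsBipartite G S
  cosetsBipartite S K∩S=∅ =
    K , aK , respects , (λ g≈h → respects (∙-congˡ g≈h)) , K∪aK , K∩aK ,
    (λ g h g∈K h∈K → K∩S=∅ (g ∙ h) (∙-mem g∈K h∈K)) ,
    (λ g h g∈aK h∈aK → K∩S=∅ (g ∙ h) (aK-product g∈aK h∈aK))

module BipartitionSides {c ℓ p} (G : Group c ℓ) (S : Pred (Group.Carrier G) p)
  (A B : Pred (Group.Carrier G) p) (A-resp : Respects G A) (B-resp : Respects G B)
  (A∪B : ∀ g → A g ⊎ B g) (A∩B : ∀ g → A g → B g → ⊥)
  (A-indep : Independent G S A) (B-indep : Independent G S B) where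
  open Group G
  open GroupProperties G using (⁻¹-involutive; \\-leftDividesˡ; \\-leftDividesʳ)
  open SetoidReasoning setoid

  SameSide : Carrier → Carrier → Set p
  SameSide g h = (A g × A h) ⊎ (B g × B h)

  sameSide-sym : ∀ {g h} → SameSide g h → SameSide h g
  sameSide-sym (inj₁ (Ag , Ah)) = inj₁ (Ah , Ag)
  sameSide-sym (inj₂ (Bg , Bh)) = inj₂ (Bh , Bg)

  sameSide-trans : ∀ {g h k} → SameSide g h → SameSide h k → SameSide g k
  sameSide-trans (inj₁ (Ag , _))  (inj₁ (_ , Ak))  = inj₁ (Ag , Ak)
  sameSide-trans (inj₂ (Bg , _))  (inj₂ (_ , Bk))  = inj₂ (Bg , Bk)
  sameSide-trans (inj₁ (_ , Ah))  (inj₂ (Bh , _))  = ⊥-elim (A∩B _ Ah Bh)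
  sameSide-trans (inj₂ (_ , Bh))  (inj₁ (Ah , _))  = ⊥-elim (A∩B _ Ah Bh)

  sameSide-resp : ∀ {g h h′} → h ≈ h′ → SameSide g h → SameSide g h′
  sameSide-resp h≈h′ (inj₁ (Ag , Ah)) = inj₁ (Ag , A-resp h≈h′ Ah)
  sameSide-resp h≈h′ (inj₂ (Bg , Bh)) = inj₂ (Bg , B-resp h≈h′ Bh)

  adjacent⇒differentSides : ∀ {g h} → CayleySumAdj G S g h → ¬ SameSide g h
  adjacent⇒differentSides g~h (inj₁ (Ag , Ah)) = A-indep _ _ Ag Ah g~h
  adjacent⇒differentSides g~h (inj₂ (Bg , Bh)) = B-indep _ _ Bg Bh g~h

  commonNeighbour⇒sameSide : ∀ {g z h} → CayleySumAdj G S g z → CayleySumAdj G S z h →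
                             SameSide g h
  commonNeighbour⇒sameSide {g} {z} {h} g~z z~h with A∪B g | A∪B z | A∪B h
  ... | inj₁ Ag | inj₁ Az | _      = ⊥-elim (A-indep g z Ag Az g~z)
  ... | inj₁ Ag | inj₂ Bz | inj₁ Ah = inj₁ (Ag , Ah)
  ... | inj₁ Ag | inj₂ Bz | inj₂ Bh = ⊥-elim (B-indep z h Bz Bh z~h)
  ... | inj₂ Bg | inj₂ Bz | _      = ⊥-elim (B-indep g z Bg Bz g~z)
  ... | inj₂ Bg | inj₁ Az | inj₂ Bh = inj₂ (Bg , Bh)
  ... | inj₂ Bg | inj₁ Az | inj₁ Ah = ⊥-elim (A-indep z h Az Ah z~h)

  Preserves : Carrier → Set (c ⊔ p)
  Preserves x = ∀ y → SameSide y (y ∙ x)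

  preserves-resp : ∀ {x x′} → x ≈ x′ → Preserves x → Preserves x′
  preserves-resp x≈x′ P y = sameSide-resp (∙-congˡ x≈x′) (P y)

  preserves-ε : Preserves ε
  preserves-ε y = sameSide-resp (sym (identityʳ y)) (sameSide-refl (A∪B y))
    where
    sameSide-refl : A y ⊎ B y → SameSide y y
    sameSide-refl (inj₁ Ay) = inj₁ (Ay , Ay)
    sameSide-refl (inj₂ By) = inj₂ (By , By)

  module Parity (S-resp : Respects G S) (S-sym : IsSymmetric G S)
    (S-conj : ConjugationClosed G S) (S-gen : Generates G S)
    (s₀ : Carrier) (s₀∈S : S s₀) where

    -- y ~ a⁻¹y⁻¹ ~ yab for a, b ∈ S, so yab is on the side of y
    sameSide-∙S∙S : ∀ y {a b} → S a → S b → SameSide y (y ∙ a ∙ b)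
    sameSide-∙S∙S y {a} {b} a∈S b∈S = commonNeighbour⇒sameSide y~z z~yab
      where
      z : Carrier
      z = a ⁻¹ ∙ y ⁻¹
      y~z : S (y ∙ z)
      y~z = S-resp (assoc y (a ⁻¹) (y ⁻¹)) (S-conj y (S-sym a∈S))
      z∙yab≈b : z ∙ (y ∙ a ∙ b) ≈ b
      z∙yab≈b = begin
        a ⁻¹ ∙ y ⁻¹ ∙ (y ∙ a ∙ b)     ≈⟨ assoc (a ⁻¹) (y ⁻¹) (y ∙ a ∙ b) ⟩
        a ⁻¹ ∙ (y ⁻¹ ∙ (y ∙ a ∙ b))   ≈⟨ ∙-congˡ (∙-congˡ (assoc y a b)) ⟩
        a ⁻¹ ∙ (y ⁻¹ ∙ (y ∙ (a ∙ b))) ≈⟨ ∙-congˡ (\\-leftDividesʳ y (a ∙ b)) ⟩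
        a ⁻¹ ∙ (a ∙ b)                ≈⟨ \\-leftDividesʳ a b ⟩
        b                             ∎
      z~yab : S (z ∙ (y ∙ a ∙ b))
      z~yab = S-resp (sym z∙yab≈b) b∈S

    preserves-∙S∙S : ∀ {a b x} → S a → S b → Preserves x → Preserves (a ∙ (b ∙ x))
    preserves-∙S∙S {a} {b} {x} a∈S b∈S P y =
      sameSide-trans (sameSide-∙S∙S y a∈S b∈S) (sameSide-resp yab∙x≈ (P (y ∙ a ∙ b)))
      where
      yab∙x≈ : y ∙ a ∙ b ∙ x ≈ y ∙ (a ∙ (b ∙ x))
      yab∙x≈ = trans (assoc (y ∙ a) b x) (assoc y a (b ∙ x))

    wordParity : ∀ w → All S w → Preserves (prod G w) ⊎ Preserves (s₀ ⁻¹ ∙ prod G w)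
    wordParity [] [] = inj₁ preserves-ε
    wordParity (x ∷ w) (x∈S ∷ w⊆S) with wordParity w w⊆S
    ... | inj₁ even = inj₂ (preserves-∙S∙S (S-sym s₀∈S) x∈S even)
    ... | inj₂ odd  = inj₁ (preserves-resp (∙-congˡ (\\-leftDividesˡ s₀ (prod G w)))
                                          (preserves-∙S∙S x∈S s₀∈S odd))

    -- the generating words use letters from S ∪ S⁻¹, which is S by symmetry
    S-fromInverse : ∀ {s} → S (s ⁻¹) → S s
    S-fromInverse {s} s⁻¹∈S = S-resp (⁻¹-involutive s) (S-sym s⁻¹∈S)

    parity : ∀ x → Preserves x ⊎ Preserves (s₀ ⁻¹ ∙ x)
    parity x with S-gen x
    ... | w , w⊆S± , w≈x with wordParity w (All.map [ (λ s → s) , S-fromInverse ]′ w⊆S±)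
    ...   | inj₁ even = inj₁ (preserves-resp w≈x even)
    ...   | inj₂ odd  = inj₂ (preserves-resp (∙-congˡ w≈x) odd)

    -- the side of ε, which is the index-two subgroup; ε ~ s₀ puts s₀ outside it
    K : Pred Carrier p
    K = SameSide ε

    ε≁s₀ : ¬ K s₀
    ε≁s₀ = adjacent⇒differentSides (S-resp (sym (identityˡ s₀)) s₀∈S)

    preserves⇒K : ∀ {x} → Preserves x → K x
    preserves⇒K {x} P = sameSide-resp (identityˡ x) (P ε)

    -- an element of K cannot be odd: then s₀ and x, hence s₀ and ε,
    -- would be on the same side although ε ~ s₀
    K⇒preserves : ∀ {x} → K x → Preserves x
    K⇒preserves {x} x∈K with parity x
    ... | inj₁ even = even
    ... | inj₂ odd  = ⊥-elim (ε≁s₀ (sameSide-trans x∈K (sameSide-sym s₀-sameSide-x)))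
      where
      s₀-sameSide-x : SameSide s₀ x
      s₀-sameSide-x = sameSide-resp (\\-leftDividesˡ s₀ x) (odd s₀)

    -- closure under products and inverses: each y ∈ K moves every x to its own side
    K-subgroup : IsSubgroup G K
    K-subgroup = record
      { respects = sameSide-resp
      ; ε-mem    = preserves⇒K preserves-ε
      ; ∙-mem    = λ {x} x∈K y∈K → sameSide-trans x∈K (K⇒preserves y∈K x)
      ; ⁻¹-mem   = λ {x} x∈K →
          sameSide-sym (sameSide-resp (inverseˡ x) (K⇒preserves x∈K (x ⁻¹)))
      }

    K-indexTwo : HasIndexTwo G K
    K-indexTwo = s₀ , ε≁s₀ , λ x → [ (λ P → inj₁ (preserves⇒K P)) ,
                                       (λ P → inj₂ (preserves⇒K P)) ]′ (parity x)

    -- ε is adjacent to every s ∈ S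
    K-missesS : DisjointFrom G K S
    K-missesS s s∈K s∈S = adjacent⇒differentSides (S-resp (sym (identityˡ s)) s∈S) s∈K

lemma2p5 : ∀ {c ℓ p} (G : Group c ℓ) → IsFinite G →
    (S : Pred (Group.Carrier G) p) → Respects G S →
    IsSymmetric G S → Generates G S → ¬ S (Group.ε G) →
    ConjugationClosed G S → ∃ S →
    (IsBipartite G S ⇔
    (Σ (Pred (Group.Carrier G) p) λ H →
    IsSubgroup G H × HasIndexTwo G H × DisjointFrom G H S))
lemma2p5 {p = p} G _ S S-resp S-sym S-gen _ S-conj (s₀ , s₀∈S) = mk⇔ sideOfε cosets
  where
  sideOfε : IsBipartite G S →
            Σ (Pred (Group.Carrier G) p) λ H → IsSubgroup G H × HasIndexTwo G H × DisjointFrom G H S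
  sideOfε (A , B , A-resp , B-resp , A∪B , A∩B , A-indep , B-indep) =
    K , K-subgroup , K-indexTwo , K-missesS
    where
    open BipartitionSides G S A B A-resp B-resp A∪B A∩B A-indep B-indep
    open Parity S-resp S-sym S-conj S-gen s₀ s₀∈S

  cosets : (Σ (Pred (Group.Carrier G) p) λ H →
              IsSubgroup G H × HasIndexTwo G H × DisjointFrom G H S) → IsBipartite G S
  cosets (H , H-subgroup , H-indexTwo , H∩S=∅) =
    IndexTwoCosets.cosetsBipartite G H-subgroup H-indexTwo S H∩S=∅
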